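{- Let $x$ be a propositional variable. Every formula-term that is strongly positive in $x$ is equivalent (i.e. has the same interpretation in every Heyting algebra under every valuation of its variables) to a formula-term in normal form with respect to $x$.
   Context: Formula-terms are formulas of intuitionistic propositional logic built from propositional variables, $\top$, $\bot$, $\wedge$, $\vee$, $\to$, interpreted in Heyting algebras in the usual way. An occurrence of $x$ in a formula-term $\phi$ is strongly positive if there is no subformula of $\phi$ of the form $\psi_0 \to \psi_1$ with that occurrence of $x$ located in $\psi_0$; $\phi$ is strongly positive in $x$ if every occurrence of $x$ in $\phi$ is strongly positive. The formula-terms disjunctive in $x$ are those generated by the grammar $\phi ::= x \mid \beta \vee \phi \mid \phi \vee \beta \mid \alpha \to \phi \mid \phi \vee \phi$, where $\alpha,\beta$ range over formulas with no occurrence of $x$. A formula-term is in normal form with respect to $x$ if it is a conjunction of formula-terms $\phi_i$, $i\in I$, each of which either does not contain $x$ or is disjunctive in $x$. -}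

module Defs where

open import Level using (Level; Setω)
open import Data.Nat using (ℕ)
open import Data.Product using (_×_)
open import Relation.Nullary using (¬_)
open import Relation.Binary.PropositionalEquality using (_≡_)
open import Relation.Binary.Lattice.Bundles using (HeytingAlgebra)

data Formula : Set where
  var  : ℕ → Formula
  ⊤'   : Formula
  ⊥'   : Formula
  _∧'_ : Formula → Formula → Formula
  _∨'_ : Formula → Formula → Formula
  _⇒'_ : Formula → Formula → Formula

data NoOcc (x : ℕ) : Formula → Set where
  var : ∀ {y} → ¬ (y ≡ x) → NoOcc x (var y)
  ⊤'  : NoOcc x ⊤'
  ⊥'  : NoOcc x ⊥'
  _∧'_ : ∀ {φ ψ} → NoOcc x φ → NoOcc x ψ → NoOcc x (φ ∧' ψ)
  _∨'_ : ∀ {φ ψ} → NoOcc x φ → NoOcc x ψ → NoOcc x (φ ∨' ψ)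
  _⇒'_ : ∀ {φ ψ} → NoOcc x φ → NoOcc x ψ → NoOcc x (φ ⇒' ψ)

data StronglyPositive (x : ℕ) : Formula → Set where
  var  : ∀ y → StronglyPositive x (var y)
  ⊤'   : StronglyPositive x ⊤'
  ⊥'   : StronglyPositive x ⊥'
  _∧'_ : ∀ {φ ψ} → StronglyPositive x φ → StronglyPositive x ψ → StronglyPositive x (φ ∧' ψ)
  _∨'_ : ∀ {φ ψ} → StronglyPositive x φ → StronglyPositive x ψ → StronglyPositive x (φ ∨' ψ)
  _⇒'_ : ∀ {φ ψ} → NoOcc x φ → StronglyPositive x ψ → StronglyPositive x (φ ⇒' ψ)

data Disjunctive (x : ℕ) : Formula → Set where
  var   : Disjunctive x (var x)
  β∨φ   : ∀ {β φ} → NoOcc x β → Disjunctive x φ → Disjunctive x (β ∨' φ)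
  φ∨β   : ∀ {β φ} → Disjunctive x φ → NoOcc x β → Disjunctive x (φ ∨' β)
  α⇒φ   : ∀ {α φ} → NoOcc x α → Disjunctive x φ → Disjunctive x (α ⇒' φ)
  φ∨φ   : ∀ {φ ψ} → Disjunctive x φ → Disjunctive x ψ → Disjunctive x (φ ∨' ψ)

data Component (x : ℕ) (φ : Formula) : Set where
  noOcc : NoOcc x φ → Component x φ
  disj  : Disjunctive x φ → Component x φ

-- Normal form w.r.t. x: a finite conjunction  ⋀_{i∈I} φ_i  of components
-- (empty conjunction = ⊤', bracketing of ∧' arbitrary).
data NormalForm (x : ℕ) : Formula → Set where
  empty : NormalForm x ⊤'
  comp  : ∀ {φ} → Component x φ → NormalForm x φ
  _∧'_  : ∀ {φ ψ} → NormalForm x φ → NormalForm x ψ → NormalForm x (φ ∧' ψ)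

module _ {c ℓ₁ ℓ₂ : Level} (H : HeytingAlgebra c ℓ₁ ℓ₂) where
  open HeytingAlgebra H
  ⟦_⟧ : Formula → (ℕ → Carrier) → Carrier
  ⟦ var n ⟧ v = v n
  ⟦ ⊤' ⟧ v = ⊤
  ⟦ ⊥' ⟧ v = ⊥
  ⟦ φ ∧' ψ ⟧ v = ⟦ φ ⟧ v ∧ ⟦ ψ ⟧ v
  ⟦ φ ∨' ψ ⟧ v = ⟦ φ ⟧ v ∨ ⟦ ψ ⟧ v
  ⟦ φ ⇒' ψ ⟧ v = ⟦ φ ⟧ v ⇨ ⟦ ψ ⟧ v

Equivalent : Formula → Formula → Setω
Equivalent φ ψ = ∀ {c ℓ₁ ℓ₂} (H : HeytingAlgebra c ℓ₁ ℓ₂) (v : ℕ → HeytingAlgebra.Carrier H) →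
  HeytingAlgebra._≈_ H (⟦ H ⟧ φ v) (⟦ H ⟧ ψ v)

-- Existential with a Setω-valued body.
record ∃NormalFormEquiv (x : ℕ) (φ : Formula) : Setω where
  constructor _,_,_
  field
    ψ          : Formula
    normalForm : NormalForm x ψ
    equivalent : Equivalent φ ψ

-- Since x never occurs in an antecedent, the formula is built from x and x-free formulas by ∧, ∨
-- and implications α → (−) with α x-free, so it suffices that normal forms are closed, up to
-- equivalence, under these operations. In every Heyting algebra
-- α ⇨ (−) and φ ∨ (−) preserve ⊤ and distribute over ∧, which reduces the other cases to a single
-- disjunction or implication of components, and such a formula is again a component.
module Submission where

open import Defs
open import Data.Nat using (ℕ)
open import Data.Nat.Properties using (_≟_)
open import Relation.Nullary using (yes; no)
open import Relation.Binary.PropositionalEquality using (refl)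
open import Relation.Binary.Lattice.Bundles using (HeytingAlgebra)
import Relation.Binary.Lattice.Properties.HeytingAlgebra as HeytingAlgebraProperties
import Relation.Binary.Lattice.Properties.DistributiveLattice as DistributiveLatticeProperties
import Relation.Binary.Lattice.Properties.BoundedLattice as BoundedLatticeProperties
import Relation.Binary.Lattice.Properties.MeetSemilattice as MeetSemilatticeProperties
import Relation.Binary.Lattice.Properties.JoinSemilattice as JoinSemilatticeProperties

module HeytingAlgebraLaws {c ℓ₁ ℓ₂} (H : HeytingAlgebra c ℓ₁ ℓ₂) where
  open HeytingAlgebra H
  open HeytingAlgebraProperties H public using (⇨-cong; ⇨-distribˡ-∧)
  open DistributiveLatticeProperties (HeytingAlgebraProperties.distributiveLattice H) public
    using (∨-distribˡ-∧; ∨-distribʳ-∧)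
  open BoundedLatticeProperties boundedLattice public using (∨-zeroˡ; ∨-zeroʳ)
  open MeetSemilatticeProperties meetSemilattice public using (∧-cong)
  open JoinSemilatticeProperties joinSemilattice public using (∨-cong)

  ⇨-zeroʳ : ∀ a → (a ⇨ ⊤) ≈ ⊤
  ⇨-zeroʳ a = antisym (maximum _) (HeytingAlgebraProperties.y≤x⇨y H)

open HeytingAlgebraLaws

≃-trans : ∀ {φ ψ χ} → Equivalent φ ψ → Equivalent ψ χ → Equivalent φ χ
≃-trans φ≃ψ ψ≃χ H v = HeytingAlgebra.Eq.trans H (φ≃ψ H v) (ψ≃χ H v)

module _ {x : ℕ} where

  normalFormEquiv-respects : ∀ {φ φ′} → Equivalent φ φ′ → ∃NormalFormEquiv x φ′ → ∃NormalFormEquiv x φ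
  normalFormEquiv-respects {φ} {φ′} φ≃φ′ (ψ , nf , φ′≃ψ) = ψ , nf , ≃-trans {φ} {φ′} {ψ} φ≃φ′ φ′≃ψ

  normalFormEquiv-refl : ∀ {φ} → NormalForm x φ → ∃NormalFormEquiv x φ
  normalFormEquiv-refl {φ} nf = φ , nf , λ H v → HeytingAlgebra.Eq.refl H

  component-∨ : ∀ {φ ψ} → Component x φ → Component x ψ → Component x (φ ∨' ψ)
  component-∨ (noOcc β) (noOcc β′) = noOcc (β ∨' β′)
  component-∨ (noOcc β) (disj δ)   = disj (β∨φ β δ)
  component-∨ (disj δ)  (noOcc β)  = disj (φ∨β δ β)
  component-∨ (disj δ)  (disj δ′)  = disj (φ∨φ δ δ′)

  component-⇒ : ∀ {α ψ} → NoOcc x α → Component x ψ → Component x (α ⇒' ψ)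
  component-⇒ α (noOcc β) = noOcc (α ⇒' β)
  component-⇒ α (disj δ)  = disj (α⇒φ α δ)

  normalFormEquiv-distrib : (f : Formula → Formula) →
    Equivalent (f ⊤') ⊤' →
    (∀ φ ψ → Equivalent (f (φ ∧' ψ)) (f φ ∧' f ψ)) →
    (∀ {φ} → Component x φ → ∃NormalFormEquiv x (f φ)) →
    ∀ {φ} → NormalForm x φ → ∃NormalFormEquiv x (f φ)
  normalFormEquiv-distrib f f⊤≃⊤ f-distrib onComponent = go
    where
    go : ∀ {φ} → NormalForm x φ → ∃NormalFormEquiv x (f φ)
    go empty     = ⊤' , empty , f⊤≃⊤
    go (comp γ)  = onComponent γ
    go (_∧'_ {φ} {ψ} nf nf′) with go nf | go nf′
    ... | χ , nfχ , fφ≃χ | χ′ , nfχ′ , fψ≃χ′ =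
      (χ ∧' χ′) , (nfχ ∧' nfχ′) ,
      ≃-trans {f (φ ∧' ψ)} {f φ ∧' f ψ} {χ ∧' χ′} (f-distrib φ ψ)
        (λ H v → ∧-cong H (fφ≃χ H v) (fψ≃χ′ H v))

  normalFormEquiv-⇒ : ∀ {α ψ} → NoOcc x α → NormalForm x ψ → ∃NormalFormEquiv x (α ⇒' ψ)
  normalFormEquiv-⇒ {α} noα = normalFormEquiv-distrib (α ⇒'_)
    (λ H v → ⇨-zeroʳ H _)
    (λ φ ψ H v → ⇨-distribˡ-∧ H _ _ _)
    (λ γ → normalFormEquiv-refl (comp (component-⇒ noα γ)))

  normalFormEquiv-∨ˡ : ∀ {φ ψ} → Component x φ → NormalForm x ψ → ∃NormalFormEquiv x (φ ∨' ψ)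
  normalFormEquiv-∨ˡ {φ} γ = normalFormEquiv-distrib (φ ∨'_)
    (λ H v → ∨-zeroʳ H _)
    (λ ψ χ H v → ∨-distribˡ-∧ H _ _ _)
    (λ γ′ → normalFormEquiv-refl (comp (component-∨ γ γ′)))

  normalFormEquiv-∨ : ∀ {φ ψ} → NormalForm x φ → NormalForm x ψ → ∃NormalFormEquiv x (φ ∨' ψ)
  normalFormEquiv-∨ {ψ = ψ} nf nf′ = normalFormEquiv-distrib (_∨' ψ)
    (λ H v → ∨-zeroˡ H _)
    (λ φ χ H v → ∨-distribʳ-∧ H _ _ _)
    (λ γ → normalFormEquiv-∨ˡ γ nf′)
    nf

  ∧-normalFormEquiv : ∀ {φ ψ} → ∃NormalFormEquiv x φ → ∃NormalFormEquiv x ψ → ∃NormalFormEquiv x (φ ∧' ψ)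
  ∧-normalFormEquiv (χ , nf , φ≃χ) (χ′ , nf′ , ψ≃χ′) =
    (χ ∧' χ′) , (nf ∧' nf′) , λ H v → ∧-cong H (φ≃χ H v) (ψ≃χ′ H v)

  ∨-normalFormEquiv : ∀ {φ ψ} → ∃NormalFormEquiv x φ → ∃NormalFormEquiv x ψ → ∃NormalFormEquiv x (φ ∨' ψ)
  ∨-normalFormEquiv (χ , nf , φ≃χ) (χ′ , nf′ , ψ≃χ′) =
    normalFormEquiv-respects (λ H v → ∨-cong H (φ≃χ H v) (ψ≃χ′ H v)) (normalFormEquiv-∨ nf nf′)

  ⇒-normalFormEquiv : ∀ {α ψ} → NoOcc x α → ∃NormalFormEquiv x ψ → ∃NormalFormEquiv x (α ⇒' ψ)
  ⇒-normalFormEquiv noα (χ , nf , ψ≃χ) =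
    normalFormEquiv-respects (λ H v → ⇨-cong H (HeytingAlgebra.Eq.refl H) (ψ≃χ H v))
      (normalFormEquiv-⇒ noα nf)

mainTheorem1 : (x : ℕ) (φ : Formula) → StronglyPositive x φ → ∃NormalFormEquiv x φ
mainTheorem1 x (var y) (var y) with y ≟ x
... | yes refl = normalFormEquiv-refl (comp (disj var))
... | no y≢x   = normalFormEquiv-refl (comp (noOcc (var y≢x)))
mainTheorem1 x ⊤' ⊤' = normalFormEquiv-refl empty
mainTheorem1 x ⊥' ⊥' = normalFormEquiv-refl (comp (noOcc ⊥'))
mainTheorem1 x (φ ∧' ψ) (p ∧' q) = ∧-normalFormEquiv (mainTheorem1 x φ p) (mainTheorem1 x ψ q)
mainTheorem1 x (φ ∨' ψ) (p ∨' q) = ∨-normalFormEquiv (mainTheorem1 x φ p) (mainTheorem1 x ψ q)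
mainTheorem1 x (α ⇒' ψ) (noα ⇒' q) = ⇒-normalFormEquiv noα (mainTheorem1 x ψ q)
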